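{- If a class $\mathcal{F}$ of graphs is $\sigma$-bounded at depth $d$ for every integer $d\ge 1$, then $\mathcal{F}$ has bounded expansion.
   Context: Graphs are finite and simple. For a vertex $v$ of $G$, $N^d(v)$ is the set of vertices at distance at most $d$ from $v$, excluding $v$. A $d$-neighborhood system for $G$ is a collection $(\Sigma(v))_{v\in V(G)}$ with $\Sigma(v)\subseteq N^d(v)$; $\rho(\Sigma)=\max_v|\Sigma(v)|$. A $\Sigma$-coloring is a coloring in which any two distinct vertices lying together in some $\Sigma(w)$ get different colors; $\chi(\Sigma)$ is the minimum number of colors of one. $\mathcal{F}$ is $\sigma$-bounded at depth $d$ if there is a function $f$ such that every $G\in\mathcal{F}$ and every $d$-neighborhood system $\Sigma$ for $G$ satisfy $\chi(\Sigma)\le f(\rho(\Sigma))$. A graph $H$ is a shallow topological minor of $G$ at depth $d$ if $G$ contains as a subgraph a graph obtained from $H$ by subdividing each edge at most $2d$ times. $\widetilde{\nabla}_d(G)$ is the maximum of $|E(H)|/|V(H)|$ over all shallow topological minors $H$ of $G$ at depth $d$. $\mathcal{F}$ has bounded expansion if there is a function $f$ such that $\widetilde{\nabla}_d(G)\le f(d)$ for all $d\ge 0$ and all $G\in\mathcal{F}$. -}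

module Defs where

open import Data.Nat using (ℕ; zero; suc; _+_; _*_; _≤_; _⊔_)
open import Data.Bool using (Bool; true; false; _∧_)
open import Data.Fin using (Fin; zero; suc; toℕ; _<?_)
open import Data.Fin.Subset using (Subset; _∈_; ∣_∣)
open import Data.List using (List; []; _∷_; _++_; length)
open import Data.List.Relation.Unary.Linked using (Linked)
open import Data.List.Relation.Unary.Unique.Propositional using (Unique)
import Data.List.Membership.Propositional as LM
open import Data.Product using (Σ; ∃; _×_; _,_)
open import Data.Empty using (⊥)
open import Relation.Nullary using (¬_; does)
open import Relation.Binary.PropositionalEquality using (_≡_; _≢_)
open import Function.Definitions using (Injective)

record Graph : Set where
  field
    n     : ℕ
    adj   : Fin n → Fin n → Bool
    irrefl : ∀ v → adj v v ≡ false
    sym    : ∀ u v → adj u v ≡ adj v u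

open Graph public

V : Graph → Set
V G = Fin (n G)

Adj : (G : Graph) → V G → V G → Set
Adj G u v = adj G u v ≡ true

count : ∀ {k} → (Fin k → Bool) → ℕ
count {zero}  p = 0
count {suc k} p = (if-one (p zero)) + count (λ i → p (suc i))
  where
  if-one : Bool → ℕ
  if-one true  = 1
  if-one false = 0

sumF : ∀ {k} → (Fin k → ℕ) → ℕ
sumF {zero}  f = 0
sumF {suc k} f = f zero + sumF (λ i → f (suc i))

maxF : ∀ {k} → (Fin k → ℕ) → ℕ
maxF {zero}  f = 0
maxF {suc k} f = f zero ⊔ maxF (λ i → f (suc i))

edgeCount : Graph → ℕ
edgeCount G = sumF (λ u → count (λ v → adj G u v ∧ does (u <? v)))

-- Distance: Reach G d u v  iff  dist(u,v) ≤ d (a walk of length ≤ d).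

data Reach (G : Graph) : ℕ → V G → V G → Set where
  here : ∀ {d v} → Reach G d v v
  step : ∀ {d u w v} → Adj G u w → Reach G d w v → Reach G (suc d) u v

InN : (G : Graph) → ℕ → V G → V G → Set
InN G d v u = (u ≢ v) × Reach G d v u

record NbhdSystem (G : Graph) (d : ℕ) : Set where
  field
    sys    : V G → Subset (n G)
    within : ∀ v u → u ∈ sys v → InN G d v u

open NbhdSystem public

ρ : ∀ {G d} → NbhdSystem G d → ℕ
ρ {G} S = maxF (λ v → ∣ sys S v ∣)

IsΣColoring : ∀ {G d} (S : NbhdSystem G d) {k : ℕ} → (V G → Fin k) → Set
IsΣColoring {G} S c =
  ∀ w u v → u ∈ sys S w → v ∈ sys S w → u ≢ v → c u ≢ c v

χ≤ : ∀ {G d} → NbhdSystem G d → ℕ → Set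
χ≤ {G} S k = Σ (V G → Fin k) (λ c → IsΣColoring S c)

GraphClass : Set₁
GraphClass = Graph → Set

σ-bounded-at-depth : GraphClass → ℕ → Set
σ-bounded-at-depth F d =
  Σ (ℕ → ℕ) λ f → ∀ (G : Graph) → F G → (S : NbhdSystem G d) → χ≤ S (f (ρ S))

record ShallowTopMinor (H G : Graph) (d : ℕ) : Set where
  field
    φ      : V H → V G
    φ-inj  : Injective _≡_ _≡_ φ
    path   : V H → V H → List (V G)
    short  : ∀ u v → Adj H u v → toℕ u Data.Nat.< toℕ v → length (path u v) ≤ 2 * d
    linked : ∀ u v → Adj H u v → toℕ u Data.Nat.< toℕ v →
             Linked (Adj G) (φ u ∷ path u v ++ φ v ∷ [])
    unique : ∀ u v → Adj H u v → toℕ u Data.Nat.< toℕ v → Unique (path u v)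
    avoid  : ∀ u v → Adj H u v → toℕ u Data.Nat.< toℕ v →
             ∀ x → x LM.∈ path u v → ∀ w → φ w ≢ x
    disj   : ∀ u v u' v' → Adj H u v → toℕ u Data.Nat.< toℕ v →
             Adj H u' v' → toℕ u' Data.Nat.< toℕ v' →
             ¬ ((u ≡ u') × (v ≡ v')) →
             ∀ x → x LM.∈ path u v → x LM.∈ path u' v' → ⊥

BoundedExpansion : GraphClass → Set
BoundedExpansion F =
  Σ (ℕ → ℕ) λ f → ∀ (d : ℕ) (G : Graph) → F G →
    ∀ (H : Graph) → ShallowTopMinor H G d → edgeCount H ≤ f d * n H

-- σ-boundedness at depth 2 already forces bounded maximum degree, and a
-- class of bounded degree has bounded expansion.
--
-- Let f witness σ-boundedness at depth 2 and t = 1 + max(f 0, f 1, f 2).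
-- Suppose a vertex x has t + t² distinct neighbours, split into t "spokes"
-- y₀ … y_{t-1} and t² "hubs" h_{ij}.  Put Σ(h_{ij}) = {y_i , y_j} (both lie
-- at distance 2 from h_{ij} via x) and Σ(w) = ∅ otherwise.  Then ρ(Σ) ≤ 2,
-- yet every Σ-colouring separates all t spokes, which needs t > f(ρ(Σ))
-- colours; so every vertex has fewer than Δ = t + t² neighbours.
--
-- If H is a shallow topological minor of G (any depth), the first
-- vertices of the paths leaving a branch vertex φ(u) towards its larger
-- H-neighbours are distinct G-neighbours of φ(u).  Hence every vertex of H has
-- fewer than Δ larger neighbours, and |E(H)| ≤ Δ·|V(H)| for every depth.
module Submission where

open import Defs
open import Data.Nat using (ℕ; zero; suc; _+_; _*_; _⊔_; _≤_; _<_; z≤n; s≤s; _≤?_)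
import Data.Nat.Properties as ℕₚ
open import Data.Bool using (Bool; true; false; _∧_)
open import Data.Fin using (Fin; zero; suc; toℕ; _<?_; _↑ˡ_; _↑ʳ_; splitAt; remQuot; combine)
open import Data.Fin.Properties
  using (_≟_; any?; pigeonhole; suc-injective; ↑ˡ-injective; ↑ʳ-injective; splitAt-↑ˡ; splitAt-↑ʳ; remQuot-combine)
open import Data.Fin.Subset using (Subset; _∈_; ∣_∣; ⁅_⁆; _∪_; ⊥)
open import Data.Fin.Subset.Properties
  using (x∈⁅x⁆; x∈⁅y⁆⇒x≡y; x∈p∪q⁻; x∈p∪q⁺; ∉⊥; ∣⊥∣≡0; ∣⁅x⁆∣≡1)
open import Data.Vec using (_∷_; [])
open import Data.List using (List; []; _∷_; _++_)
open import Data.List.Relation.Unary.Linked using (Linked; _∷_)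
open import Data.List.Relation.Unary.Any using (here)
import Data.List.Membership.Propositional as List
open import Data.Product using (∃; _×_; _,_; proj₁; proj₂)
open import Data.Sum using (inj₁; inj₂)
import Data.Empty as Empty
open import Relation.Nullary using (¬_; Dec; yes; no; does)
open import Relation.Binary.PropositionalEquality
  using (_≡_; _≢_; refl; trans; cong; cong₂; subst) renaming (sym to ≡-sym)
open import Function.Definitions using (Injective)

Inj : ∀ {A B : Set} → (A → B) → Set
Inj f = Injective _≡_ _≡_ f

∣p∪q∣≤∣p∣+∣q∣ : ∀ {m} (p q : Subset m) → ∣ p ∪ q ∣ ≤ ∣ p ∣ + ∣ q ∣
∣p∪q∣≤∣p∣+∣q∣ []          []          = z≤n
∣p∪q∣≤∣p∣+∣q∣ (true ∷ p)  (true ∷ q)  =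
  s≤s (ℕₚ.≤-trans (ℕₚ.m≤n⇒m≤1+n (∣p∪q∣≤∣p∣+∣q∣ p q)) (ℕₚ.≤-reflexive (≡-sym (ℕₚ.+-suc ∣ p ∣ ∣ q ∣))))
∣p∪q∣≤∣p∣+∣q∣ (true ∷ p)  (false ∷ q) = s≤s (∣p∪q∣≤∣p∣+∣q∣ p q)
∣p∪q∣≤∣p∣+∣q∣ (false ∷ p) (true ∷ q)  =
  ℕₚ.≤-trans (s≤s (∣p∪q∣≤∣p∣+∣q∣ p q)) (ℕₚ.≤-reflexive (≡-sym (ℕₚ.+-suc ∣ p ∣ ∣ q ∣)))
∣p∪q∣≤∣p∣+∣q∣ (false ∷ p) (false ∷ q) = ∣p∪q∣≤∣p∣+∣q∣ p q

maxF-lub : ∀ {k} (f : Fin k → ℕ) c → (∀ i → f i ≤ c) → maxF f ≤ c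
maxF-lub {zero}  f c bound = z≤n
maxF-lub {suc k} f c bound =
  ℕₚ.⊔-lub (bound zero) (maxF-lub (λ i → f (suc i)) c (λ i → bound (suc i)))

sumF-≤ : ∀ {k} (f : Fin k → ℕ) c → (∀ i → f i ≤ c) → sumF f ≤ c * k
sumF-≤ {zero}  f c bound = ℕₚ.≤-reflexive (≡-sym (ℕₚ.*-zeroʳ c))
sumF-≤ {suc k} f c bound =
  ℕₚ.≤-trans (ℕₚ.+-mono-≤ (bound zero) (sumF-≤ (λ i → f (suc i)) c (λ i → bound (suc i))))
             (ℕₚ.≤-reflexive (≡-sym (ℕₚ.*-suc c k)))

Family : ∀ {k} → (Fin k → Bool) → ℕ → Set
Family {k} p M = ∃ λ (e : Fin M → Fin k) → Inj e × (∀ i → p (e i) ≡ true)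

enumerate : ∀ {k} (p : Fin k → Bool) M → M ≤ count p → Family p M
enumerate {zero}  p zero     _ = (λ ()) , (λ {i} → λ { }) , λ ()
enumerate {suc k} p M        bound with p zero in p0
enumerate {suc k} p M        bound       | false with enumerate (λ i → p (suc i)) M bound
... | e , e-inj , e-sat = (λ i → suc (e i)) , (λ eq → e-inj (suc-injective eq)) , e-sat
enumerate {suc k} p zero     _           | true = (λ ()) , (λ {i} → λ { }) , λ ()
enumerate {suc k} p (suc M) (s≤s bound) | true with enumerate (λ i → p (suc i)) M bound
... | e , e-inj , e-sat = e′ , e′-inj , e′-sat
  where
  e′ : Fin (suc M) → Fin (suc k)
  e′ zero    = zero
  e′ (suc i) = suc (e i)
  e′-inj : Inj e′
  e′-inj {zero}  {zero}  _  = refl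
  e′-inj {suc i} {suc j} eq = cong suc (e-inj (suc-injective eq))
  e′-sat : ∀ i → p (e′ i) ≡ true
  e′-sat zero    = p0
  e′-sat (suc i) = e-sat i

count-<-if-no-family : ∀ {k} (p : Fin k → Bool) M → ¬ Family p M → count p < M
count-<-if-no-family p M noFamily with M ≤? count p
... | yes M≤count = Empty.⊥-elim (noFamily (enumerate p M M≤count))
... | no  M≰count = ℕₚ.≰⇒> M≰count

maxUpTo : (ℕ → ℕ) → ℕ → ℕ
maxUpTo f zero    = f zero
maxUpTo f (suc k) = maxUpTo f k ⊔ f (suc k)

f≤maxUpTo : ∀ f {r} k → r ≤ k → f r ≤ maxUpTo f k
f≤maxUpTo f {zero}  zero    z≤n = ℕₚ.≤-refl
f≤maxUpTo f {r}     (suc k) r≤1+k with r ≤? k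
... | yes r≤k = ℕₚ.≤-trans (f≤maxUpTo f k r≤k) (ℕₚ.m≤m⊔n (maxUpTo f k) (f (suc k)))
... | no  r≰k rewrite ℕₚ.≤-antisym r≤1+k (ℕₚ.≰⇒> r≰k) = ℕₚ.m≤n⊔m (maxUpTo f k) (f (suc k))

NeighbourFamily : (G : Graph) → V G → ℕ → Set
NeighbourFamily G x m = ∃ λ (e : Fin m → V G) → Inj e × (∀ i → Adj G x (e i))

ColourBound₂ : Graph → (ℕ → ℕ) → Set
ColourBound₂ G f = ∀ (T : NbhdSystem G 2) → χ≤ T (f (ρ T))

module PairSystem (G : Graph) (x : V G) (t : ℕ) (e : Fin (t + t * t) → V G)
                  (e-inj : Inj e) (e-adj : ∀ i → Adj G x (e i)) where

  spoke : Fin t → V G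
  spoke i = e (i ↑ˡ (t * t))

  hub : Fin (t * t) → V G
  hub p = e (t ↑ʳ p)

  spoke-inj : Inj spoke
  spoke-inj eq = ↑ˡ-injective (t * t) _ _ (e-inj eq)

  hub-inj : Inj hub
  hub-inj eq = ↑ʳ-injective t _ _ (e-inj eq)

  spoke≢hub : ∀ i p → spoke i ≢ hub p
  spoke≢hub i p eq with trans (≡-sym (splitAt-↑ˡ t i (t * t)))
                             (trans (cong (splitAt t) (e-inj eq)) (splitAt-↑ʳ t (t * t) p))
  ... | ()

  pairAt : Fin (t * t) → Subset (n G)
  pairAt p = ⁅ spoke (proj₁ (remQuot {t} t p)) ⁆ ∪ ⁅ spoke (proj₂ (remQuot {t} t p)) ⁆

  sysAt : ∀ {w} → Dec (∃ λ p → hub p ≡ w) → Subset (n G)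
  sysAt (yes (p , _)) = pairAt p
  sysAt (no _)        = ⊥

  isHub? : ∀ w → Dec (∃ λ p → hub p ≡ w)
  isHub? w = any? (λ p → hub p ≟ w)

  spoke-near-hub : ∀ p i → InN G 2 (hub p) (spoke i)
  spoke-near-hub p i = spoke≢hub i p
                     , step (trans (Graph.sym G (hub p) x) (e-adj _)) (step (e-adj _) here)

  pairAt-within : ∀ p u → u ∈ pairAt p → InN G 2 (hub p) u
  pairAt-within p u u∈ with x∈p∪q⁻ ⁅ spoke (proj₁ (remQuot {t} t p)) ⁆ _ u∈
  ... | inj₁ u∈₁ rewrite x∈⁅y⁆⇒x≡y _ u∈₁ = spoke-near-hub p _
  ... | inj₂ u∈₂ rewrite x∈⁅y⁆⇒x≡y _ u∈₂ = spoke-near-hub p _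

  sysAt-within : ∀ {w} (h? : Dec (∃ λ p → hub p ≡ w)) u → u ∈ sysAt h? → InN G 2 w u
  sysAt-within (yes (p , refl)) u u∈ = pairAt-within p u u∈
  sysAt-within (no _)           u u∈ = Empty.⊥-elim (∉⊥ u∈)

  Σ₂ : NbhdSystem G 2
  Σ₂ = record { sys = λ w → sysAt (isHub? w) ; within = λ w → sysAt-within (isHub? w) }

  sysAt-size : ∀ {w} (h? : Dec (∃ λ p → hub p ≡ w)) → ∣ sysAt h? ∣ ≤ 2
  sysAt-size (yes (p , _)) =
    ℕₚ.≤-trans (∣p∪q∣≤∣p∣+∣q∣ ⁅ yᵢ ⁆ ⁅ yⱼ ⁆) (ℕₚ.≤-reflexive (cong₂ _+_ (∣⁅x⁆∣≡1 yᵢ) (∣⁅x⁆∣≡1 yⱼ)))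
    where
    yᵢ yⱼ : V G
    yᵢ = spoke (proj₁ (remQuot {t} t p))
    yⱼ = spoke (proj₂ (remQuot {t} t p))
  sysAt-size (no _) = ℕₚ.≤-trans (ℕₚ.≤-reflexive (∣⊥∣≡0 (n G))) z≤n

  ρΣ₂≤2 : ρ Σ₂ ≤ 2
  ρΣ₂≤2 = maxF-lub _ 2 (λ w → sysAt-size (isHub? w))

  spokes-in-pairAt : ∀ i j → spoke i ∈ pairAt (combine i j) × spoke j ∈ pairAt (combine i j)
  spokes-in-pairAt i j =
      subst (λ k → spoke k ∈ pairAt (combine i j)) (cong proj₁ (remQuot-combine {t} {t} i j))
            (x∈p∪q⁺ (inj₁ (x∈⁅x⁆ _)))
    , subst (λ k → spoke k ∈ pairAt (combine i j)) (cong proj₂ (remQuot-combine {t} {t} i j))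
            (x∈p∪q⁺ (inj₂ (x∈⁅x⁆ _)))

  spokes-in-hub : ∀ i j → spoke i ∈ sys Σ₂ (hub (combine i j)) × spoke j ∈ sys Σ₂ (hub (combine i j))
  spokes-in-hub i j = members (isHub? (hub (combine i j)))
    where
    members : (h? : Dec (∃ λ p → hub p ≡ hub (combine i j))) → spoke i ∈ sysAt h? × spoke j ∈ sysAt h?
    members (no notHub) = Empty.⊥-elim (notHub (combine i j , refl))
    members (yes (p , eq)) with hub-inj eq
    ... | refl = spokes-in-pairAt i j

  -- A Σ₂-colouring is injective on the spokes, so it uses at least t colours.
  spokes-need-colours : ∀ {k} → χ≤ Σ₂ k → t ≤ k
  spokes-need-colours {k} (c , proper) with t ≤? k
  ... | yes t≤k = t≤k
  ... | no  t≰k with pigeonhole (ℕₚ.≰⇒> t≰k) (λ i → c (spoke i))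
  ...   | i , j , i<j , same = Empty.⊥-elim (proper _ _ _ yi∈ yj∈ yi≢yj same)
    where
    yi∈ : spoke i ∈ sys Σ₂ (hub (combine i j))
    yi∈ = proj₁ (spokes-in-hub i j)
    yj∈ : spoke j ∈ sys Σ₂ (hub (combine i j))
    yj∈ = proj₂ (spokes-in-hub i j)
    yi≢yj : spoke i ≢ spoke j
    yi≢yj eq = ℕₚ.<-irrefl (cong toℕ (spoke-inj eq)) i<j

Δ : (ℕ → ℕ) → ℕ
Δ f = suc (maxUpTo f 2) + suc (maxUpTo f 2) * suc (maxUpTo f 2)

no-large-star : ∀ G f x → ColourBound₂ G f → ¬ NeighbourFamily G x (Δ f)
no-large-star G f x colourBound (e , e-inj , e-adj) = ℕₚ.<-irrefl refl (ℕₚ.≤-trans t≤χ χ≤max)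
  where
  open PairSystem G x (suc (maxUpTo f 2)) e e-inj e-adj
  t≤χ : suc (maxUpTo f 2) ≤ f (ρ Σ₂)
  t≤χ = spokes-need-colours (colourBound Σ₂)
  χ≤max : f (ρ Σ₂) ≤ maxUpTo f 2
  χ≤max = f≤maxUpTo f 2 ρΣ₂≤2

firstStep : ∀ {A : Set} → List A → A → A
firstStep []      b = b
firstStep (z ∷ _) b = z

firstStep-adj : ∀ {A : Set} {R : A → A → Set} {a b : A} ps →
                Linked R (a ∷ ps ++ b ∷ []) → R a (firstStep ps b)
firstStep-adj []      (r ∷ _) = r
firstStep-adj (_ ∷ _) (r ∷ _) = r

firstStep-distinct : ∀ {A : Set} (ps ps′ : List A) (b b′ : A) → b ≢ b′ →
  (∀ z → z List.∈ ps → b′ ≢ z) → (∀ z → z List.∈ ps′ → b ≢ z) →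
  (∀ z → z List.∈ ps → z List.∈ ps′ → Empty.⊥) →
  firstStep ps b ≢ firstStep ps′ b′
firstStep-distinct []      []       b b′ b≢b′ _ _ _ = b≢b′
firstStep-distinct []      (z ∷ _)  b b′ _ _ avoid′ _ eq = avoid′ z (here refl) eq
firstStep-distinct (z ∷ _) []       b b′ _ avoid _ _  eq = avoid z (here refl) (≡-sym eq)
firstStep-distinct (z ∷ _) (z′ ∷ _) b b′ _ _ _ disjoint eq = disjoint z (here refl) (here eq)

forward : (H : Graph) → V H → V H → Bool
forward H u v = adj H u v ∧ does (u <? v)

forward-adj : ∀ H u v → forward H u v ≡ true → Adj H u v × toℕ u < toℕ v
forward-adj H u v fwd = both (adj H u v) (u <? v) fwd
  where
  both : ∀ {P : Set} b (p? : Dec P) → b ∧ does p? ≡ true → b ≡ true × P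
  both true (yes p) _ = refl , p

forward-to-neighbours : ∀ {H G d} (M : ShallowTopMinor H G d) u {m} →
  Family (forward H u) m → NeighbourFamily G (ShallowTopMinor.φ M u) m
forward-to-neighbours {H} {G} M u {m} (e , e-inj , e-fwd) = g , g-inj , g-adj
  where
  open ShallowTopMinor M
  a : ∀ i → Adj H u (e i)
  a i = proj₁ (forward-adj H u (e i) (e-fwd i))
  l : ∀ i → toℕ u < toℕ (e i)
  l i = proj₂ (forward-adj H u (e i) (e-fwd i))
  g : Fin m → V G
  g i = firstStep (path u (e i)) (φ (e i))
  g-adj : ∀ i → Adj G (φ u) (g i)
  g-adj i = firstStep-adj (path u (e i)) (linked u (e i) (a i) (l i))
  g-inj : Inj g
  g-inj {i} {j} eq with e i ≟ e j
  ... | yes same = e-inj same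
  ... | no  diff = Empty.⊥-elim (firstStep-distinct (path u (e i)) (path u (e j)) _ _
          (λ eq′ → diff (φ-inj eq′))
          (λ z z∈ → avoid u (e i) (a i) (l i) z z∈ (e j))
          (λ z z∈ → avoid u (e j) (a j) (l j) z z∈ (e i))
          (λ z z∈ z∈′ → disj u (e i) u (e j) (a i) (l i) (a j) (l j) (λ same → diff (proj₂ same)) z z∈ z∈′)
          eq)

minor-edge-bound : ∀ {H G d} D → (∀ x → ¬ NeighbourFamily G x D) →
  ShallowTopMinor H G d → edgeCount H ≤ D * n H
minor-edge-bound {H} D noStar M = sumF-≤ _ D forward-degree
  where
  forward-degree : ∀ u → count (forward H u) ≤ D
  forward-degree u = ℕₚ.<⇒≤ (count-<-if-no-family (forward H u) D
    (λ fam → noStar _ (forward-to-neighbours M u fam)))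

lemma14 : (F : GraphClass) →
    (∀ (d : ℕ) → 1 ≤ d → σ-bounded-at-depth F d) →
    BoundedExpansion F
lemma14 F σ-bounded with σ-bounded 2 (s≤s z≤n)
... | f , colourBound =
  (λ _ → Δ f) , λ d G G∈F H M →
    minor-edge-bound (Δ f) (λ x → no-large-star G f x (colourBound G G∈F)) M
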